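{- Let $k\ge 1$, let $C_{2^k}$ be the cycle with vertices $v_1,v_2,\dots,v_{2^k}$ in cyclic order, and let $P_{2^k-1}=C_{2^k}\setminus\{v_{2^k}\}$ be the path $v_1v_2\cdots v_{2^k-1}$. If an edge $e$ (with both endpoints in $\{v_1,\dots,v_{2^k-1}\}$, not an edge of the path) is good for $P_{2^k-1}$, then $e$ is good for $C_{2^k}$.
   Context: A $k$-ranking of a graph $G$ is a labeling $f:V(G)\to\{1,\dots,k\}$ such that whenever $f(u)=f(v)$ for distinct $u,v$, every $u$–$v$ path contains a vertex $w$ with $f(w)>f(u)$; the rank number $\chi_r(G)$ is the smallest $k$ for which $G$ has a $k$-ranking. An edge $e$ on $V(G)$ not in $G$ is good for $G$ if $\chi_r(G\cup\{e\})=\chi_r(G)$. -}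

module Defs where

open import Level using (0ℓ)
open import Data.Nat using (ℕ; zero; suc; _+_; _∸_; _^_; _≤_; _<_)
open import Data.Fin using (Fin; toℕ; fromℕ; inject₁)
open import Data.List using (List; []; _∷_)
open import Data.List.Relation.Unary.Any using (Any)
open import Data.List.Relation.Unary.Unique.Propositional using (Unique)
open import Data.Product using (Σ; _×_; _,_)
open import Data.Sum using (_⊎_)
open import Relation.Binary.PropositionalEquality using (_≡_; _≢_)
open import Relation.Nullary using (¬_)

Graph : ℕ → Set₁
Graph n = Fin n → Fin n → Set

data Walk {n : ℕ} (G : Graph n) : Fin n → Fin n → Set where
  [_] : (u : Fin n) → Walk G u u
  _∷_ : ∀ {u w v} → G u w → Walk G w v → Walk G u v

vertices : ∀ {n} {G : Graph n} {u v : Fin n} → Walk G u v → List (Fin n)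
vertices [ u ] = u ∷ []
vertices (_∷_ {u = u} _ p) = u ∷ vertices p

IsPath : ∀ {n} {G : Graph n} {u v : Fin n} → Walk G u v → Set
IsPath p = Unique (vertices p)

IsRanking : ∀ {n} → Graph n → ℕ → (Fin n → ℕ) → Set
IsRanking {n} G k f =
  (∀ v → 1 ≤ f v × f v ≤ k) ×
  (∀ u v → u ≢ v → f u ≡ f v → (p : Walk G u v) → IsPath p →
     Any (λ w → f u < f w) (vertices p))

HasRanking : ∀ {n} → Graph n → ℕ → Set
HasRanking G k = Σ _ (IsRanking G k)

RankNumber : ∀ {n} → Graph n → ℕ → Set
RankNumber G r = HasRanking G r × (∀ s → HasRanking G s → r ≤ s)

addEdge : ∀ {n} → Graph n → Fin n → Fin n → Graph n
addEdge G a b x y = G x y ⊎ ((x ≡ a × y ≡ b) ⊎ (x ≡ b × y ≡ a))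

IsGood : ∀ {n} → Graph n → Fin n → Fin n → Set
IsGood G a b = Σ ℕ (λ r → RankNumber G r × RankNumber (addEdge G a b) r)

-- Path P_m on vertices 0,…,m-1 (vertex i is v_{i+1}).
PathGraph : (m : ℕ) → Graph m
PathGraph m x y = (suc (toℕ x) ≡ toℕ y) ⊎ (suc (toℕ y) ≡ toℕ x)

-- Cycle C_{m+1} on vertices 0,…,m (vertex m is the last vertex v_{m+1}).
CycleGraph : (m : ℕ) → Graph (suc m)
CycleGraph m x y =
  (suc (toℕ x) ≡ toℕ y) ⊎ (suc (toℕ y) ≡ toℕ x) ⊎
  ((toℕ x ≡ 0 × toℕ y ≡ m) ⊎ (toℕ y ≡ 0 × toℕ x ≡ m))

-- The argument works for a path of any length m, not only 2^k − 1: a ranking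
-- of C_{m+1} restricts, after deleting a vertex carrying its (unique) top label,
-- to a ranking of P_m with one label fewer, so χ_r(C_{m+1}) ≥ χ_r(P_m) + 1.
-- Conversely an r-ranking of P_m ∪ {e} extends to an (r+1)-ranking of
-- C_{m+1} ∪ {e} by giving v_{m+1} the new label r + 1, since every path through
-- v_{m+1} is then ranked by it. Hence if e is good for P_m, both C_{m+1} and
-- C_{m+1} ∪ {e} have rank number χ_r(P_m) + 1.
module Submission where

open import Defs
open import Data.Nat using (ℕ; _≤_; _∸_; _^_)
open import Data.Fin using (Fin; inject₁)
open import Relation.Binary.PropositionalEquality using (_≢_)
open import Relation.Nullary using (¬_)

open import Data.Nat using (zero; suc; _+_; _<_; z≤n; s≤s; _≤?_)
import Data.Nat as ℕ
open import Data.Nat.Properties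
open import Data.Fin using (zero; suc; toℕ; fromℕ; fromℕ<)
import Data.Fin as Fin
open import Data.Fin.Properties using (toℕ-injective; toℕ-fromℕ<; toℕ<n; toℕ-inject₁; toℕ-inject₁-≢; inject₁-injective; any?)
open import Data.List using (_∷_; map)
open import Data.List.Membership.Propositional using (_∈_)
open import Data.List.Relation.Unary.Any as Any using (Any; here; there; satisfied)
import Data.List.Relation.Unary.Any.Properties as Any
open import Data.List.Relation.Unary.All as All using (All; []; _∷_)
open import Data.List.Relation.Unary.AllPairs using ([]; _∷_)
open import Data.List.Relation.Unary.Unique.Propositional using (Unique)
import Data.List.Relation.Unary.Unique.Propositional.Properties as Unique
open import Data.Product using (Σ; _×_; _,_; proj₁; proj₂)
open import Data.Sum using (_⊎_; inj₁; inj₂)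
open import Data.Empty using (⊥-elim)
open import Relation.Nullary using (yes; no)
open import Relation.Binary.PropositionalEquality using (_≡_; refl; sym; trans; cong; subst; subst₂; module ≡-Reasoning)
open import Function using (_∘_; id)
open import Function.Definitions using (Injective)

Ranks : ∀ {n} → Graph n → (Fin n → ℕ) → Set
Ranks G f = ∀ u v → u ≢ v → f u ≡ f v → (p : Walk G u v) → IsPath p →
  Any (λ w → f u < f w) (vertices p)

PathBetween : ∀ {n} → Graph n → Fin n → Fin n → Set
PathBetween G x y = Σ (Walk G x y) IsPath

module _ {n n′} {G : Graph n} {H : Graph n′} (φ : Fin n → Fin n′)
         (hom : ∀ {x y} → G x y → H (φ x) (φ y)) where

  mapWalk : ∀ {u v} → Walk G u v → Walk H (φ u) (φ v)
  mapWalk [ u ] = [ φ u ]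
  mapWalk (e ∷ p) = hom e ∷ mapWalk p

  vertices-mapWalk : ∀ {u v} (p : Walk G u v) → vertices (mapWalk p) ≡ map φ (vertices p)
  vertices-mapWalk [ u ] = refl
  vertices-mapWalk (e ∷ p) = cong (φ _ ∷_) (vertices-mapWalk p)

  Ranks-pullback : Injective _≡_ _≡_ φ → ∀ {h} → Ranks H h → Ranks G (h ∘ φ)
  Ranks-pullback φ-inj ranks u v u≢v same p p-path =
    Any.map⁻ (subst (Any _) (vertices-mapWalk p)
      (ranks (φ u) (φ v) (u≢v ∘ φ-inj) same (mapWalk p)
        (subst Unique (sym (vertices-mapWalk p)) (Unique.map⁺ φ-inj p-path))))

IsRanking-subgraph : ∀ {n} {G H : Graph n} {k f} → (∀ {x y} → G x y → H x y) →
                     IsRanking H k f → IsRanking G k f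
IsRanking-subgraph G⊆H (bounds , ranks) = bounds , Ranks-pullback id G⊆H id ranks

topLabels-not-joined : ∀ {n} {G : Graph n} {h s} → Ranks G h → (∀ v → h v ≤ s) →
                       ∀ {x y} → x ≢ y → h x ≡ s → h y ≡ s → ¬ PathBetween G x y
topLabels-not-joined {h = h} ranks bounded {x} {y} x≢y hx hy (p , p-path)
  with satisfied (ranks x y x≢y (trans hx (sym hy)) p p-path)
... | z , hx<hz = <-irrefl hx (<-≤-trans hx<hz (bounded z))

topLabel-unique : ∀ {n} {G : Graph n} {h s} → Ranks G h → (∀ v → h v ≤ s) →
                  (∀ x y → PathBetween G x y ⊎ PathBetween G y x) →
                  ∀ {v w} → h v ≡ s → h w ≡ s → v ≡ w
topLabel-unique ranks bounded joined {v} {w} hv hw with v Fin.≟ w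
... | yes v≡w = v≡w
... | no v≢w with joined v w
...   | inj₁ p = ⊥-elim (topLabels-not-joined ranks bounded v≢w hv hw p)
...   | inj₂ p = ⊥-elim (topLabels-not-joined ranks bounded (v≢w ∘ sym) hw hv p)

topLabel-vertex : ∀ {n} {G : Graph (suc n)} {h s} → Ranks G h → (∀ v → h v ≤ s) →
                  (∀ x y → PathBetween G x y ⊎ PathBetween G y x) →
                  Σ (Fin (suc n)) λ w → ∀ v → v ≢ w → h v < s
topLabel-vertex {h = h} {s} ranks bounded joined with any? (λ v → h v ℕ.≟ s)
... | yes (w , hw) = w , λ v v≢w → ≤∧≢⇒< (bounded v) (v≢w ∘ λ hv → topLabel-unique ranks bounded joined hv hw)
... | no noTop = zero , λ v _ → ≤∧≢⇒< (bounded v) (λ hv → noTop (v , hv))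

MonotonePath : ∀ {n} → Fin n → Fin n → Set
MonotonePath {n} x y = Σ (Walk (PathGraph n) x y) λ p → IsPath p × All (λ z → toℕ x ≤ toℕ z) (vertices p)

monotonePath-cons : ∀ {n} {x x′ y : Fin n} → toℕ x′ ≡ suc (toℕ x) → MonotonePath x′ y → MonotonePath x y
monotonePath-cons {x = x} x′≡x+1 (p , p-path , p-above) =
  (inj₁ (sym x′≡x+1) ∷ p) , (All.map x≢ p-above ∷ p-path) , (≤-refl ∷ All.map (≤-trans (n≤1+n _) ∘ x+1≤) p-above)
  where
  x+1≤ : ∀ {z} → toℕ _ ≤ toℕ z → suc (toℕ x) ≤ toℕ z
  x+1≤ = subst (_≤ _) x′≡x+1
  x≢ : ∀ {z} → toℕ _ ≤ toℕ z → x ≢ z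
  x≢ x′≤z refl = <-irrefl refl (x+1≤ x′≤z)

monotonePath : ∀ {n} (x y : Fin n) d → toℕ x + d ≡ toℕ y → MonotonePath x y
monotonePath x y zero x+0≡y with toℕ-injective (trans (sym (+-identityʳ (toℕ x))) x+0≡y)
... | refl = [ x ] , ([] ∷ []) , (≤-refl ∷ [])
monotonePath {n} x y (suc d) x+d+1≡y =
  monotonePath-cons x′≡x+1 (monotonePath x′ y d (trans (cong (_+ d) x′≡x+1) x+1+d≡y))
  where
  x+1+d≡y : suc (toℕ x) + d ≡ toℕ y
  x+1+d≡y = trans (sym (+-suc (toℕ x) d)) x+d+1≡y
  x+1<n : suc (toℕ x) < n
  x+1<n = ≤-<-trans (s≤s (m≤m+n (toℕ x) d)) (subst (_< n) (sym x+1+d≡y) (toℕ<n y))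
  x′ : Fin n
  x′ = fromℕ< x+1<n
  x′≡x+1 : toℕ x′ ≡ suc (toℕ x)
  x′≡x+1 = toℕ-fromℕ< x+1<n

PathGraph-joined : ∀ {n} (x y : Fin n) → PathBetween (PathGraph n) x y ⊎ PathBetween (PathGraph n) y x
PathGraph-joined x y with ≤-total (toℕ x) (toℕ y)
... | inj₁ x≤y = let p , p-path , _ = monotonePath x y _ (m+[n∸m]≡n x≤y) in inj₁ (p , p-path)
... | inj₂ y≤x = let p , p-path , _ = monotonePath y x _ (m+[n∸m]≡n y≤x) in inj₂ (p , p-path)

PathGraph⊆CycleGraph : ∀ {m x y} → PathGraph (suc m) x y → CycleGraph m x y
PathGraph⊆CycleGraph (inj₁ e) = inj₁ e
PathGraph⊆CycleGraph (inj₂ e) = inj₂ (inj₁ e)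

module Rotation (m W c : ℕ) (W+c≡m : W + c ≡ m) where

  rotate : ℕ → ℕ
  rotate i with c ≤? i
  ... | yes _ = i ∸ c
  ... | no _ = suc W + i

  ∸-below : ∀ {i} → c ≤ i → i < m → i ∸ c < W
  ∸-below {i} c≤i i<m = +-cancelʳ-< c (i ∸ c) W (subst₂ _<_ (sym (m∸n+n≡m c≤i)) (sym W+c≡m) i<m)

  W<1+W+i : ∀ i → W < suc W + i
  W<1+W+i i = s≤s (m≤m+n W i)

  rotate-< : ∀ {i} → i < m → rotate i < suc m
  rotate-< {i} i<m with c ≤? i
  ... | yes c≤i = ≤-trans (∸-below c≤i i<m) (≤-trans (m≤m+n W c) (subst (_≤ suc m) (sym W+c≡m) (n≤1+n m)))
  ... | no c≰i = s≤s (subst (suc W + i ≤_) W+c≡m (subst (_≤ W + c) (+-suc W i) (+-monoʳ-≤ W (≰⇒> c≰i))))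

  rotate-≢ : ∀ {i} → i < m → rotate i ≢ W
  rotate-≢ {i} i<m with c ≤? i
  ... | yes c≤i = λ eq → <-irrefl eq (∸-below c≤i i<m)
  ... | no _ = λ eq → <-irrefl (sym eq) (W<1+W+i i)

  rotate-injective : ∀ {i j} → i < m → j < m → rotate i ≡ rotate j → i ≡ j
  rotate-injective {i} {j} i<m j<m eq with c ≤? i | c ≤? j
  ... | yes c≤i | yes c≤j = ∸-cancelʳ-≡ c≤i c≤j eq
  ... | no _ | no _ = +-cancelˡ-≡ (suc W) i j eq
  ... | yes c≤i | no _ = ⊥-elim (<-irrefl eq (<-trans (∸-below c≤i i<m) (W<1+W+i j)))
  ... | no _ | yes c≤j = ⊥-elim (<-irrefl (sym eq) (<-trans (∸-below c≤j j<m) (W<1+W+i i)))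

  rotate-suc : ∀ {i} → suc i < m → suc (rotate i) ≡ rotate (suc i) ⊎ (rotate i ≡ m × rotate (suc i) ≡ 0)
  rotate-suc {i} _ with c ≤? i | c ≤? suc i
  ... | yes c≤i | yes _ = inj₁ (sym (+-∸-assoc 1 c≤i))
  ... | yes c≤i | no c≰1+i = ⊥-elim (c≰1+i (≤-trans c≤i (n≤1+n i)))
  ... | no _ | no _ = inj₁ (cong suc (sym (+-suc W i)))
  ... | no c≰i | yes c≤1+i = inj₂ (trans (sym (+-suc W i)) (trans (cong (W +_) (sym c≡1+i)) W+c≡m) ,
                                   trans (cong (suc i ∸_) c≡1+i) (n∸n≡0 (suc i)))
    where
    c≡1+i : c ≡ suc i
    c≡1+i = ≤-antisym c≤1+i (≰⇒> c≰i)

CycleGraph-sym : ∀ {m x y} → CycleGraph m x y → CycleGraph m y x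
CycleGraph-sym (inj₁ e) = inj₂ (inj₁ e)
CycleGraph-sym (inj₂ (inj₁ e)) = inj₁ e
CycleGraph-sym (inj₂ (inj₂ (inj₁ e))) = inj₂ (inj₂ (inj₂ e))
CycleGraph-sym (inj₂ (inj₂ (inj₂ e))) = inj₂ (inj₂ (inj₁ e))

-- ψ lists the vertices of C_{m+1} other than w, starting just after w: i ↦ (w + 1 + i) mod (m + 1).
module CycleMinusVertex (m : ℕ) (w : Fin (suc m)) where
  open Rotation m (toℕ w) (m ∸ toℕ w) (m+[n∸m]≡n (≤-pred (toℕ<n w)))

  ψ : Fin m → Fin (suc m)
  ψ i = fromℕ< (rotate-< (toℕ<n i))

  toℕ-ψ : ∀ i → toℕ (ψ i) ≡ rotate (toℕ i)
  toℕ-ψ i = toℕ-fromℕ< _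

  ψ-injective : Injective _≡_ _≡_ ψ
  ψ-injective {x} {y} eq = toℕ-injective (rotate-injective (toℕ<n x) (toℕ<n y)
    (trans (sym (toℕ-ψ x)) (trans (cong toℕ eq) (toℕ-ψ y))))

  ψ-≢ : ∀ i → ψ i ≢ w
  ψ-≢ i eq = rotate-≢ (toℕ<n i) (trans (sym (toℕ-ψ i)) (cong toℕ eq))

  ψ-successor : ∀ {x y} → suc (toℕ x) ≡ toℕ y → CycleGraph m (ψ x) (ψ y)
  ψ-successor {x} {y} x+1≡y with rotate-suc (subst (_< m) (sym x+1≡y) (toℕ<n y))
  ... | inj₁ step = inj₁ (begin
    suc (toℕ (ψ x))        ≡⟨ cong suc (toℕ-ψ x) ⟩
    suc (rotate (toℕ x))   ≡⟨ step ⟩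
    rotate (suc (toℕ x))   ≡⟨ cong rotate x+1≡y ⟩
    rotate (toℕ y)         ≡⟨ toℕ-ψ y ⟨
    toℕ (ψ y)              ∎)
    where open ≡-Reasoning
  ... | inj₂ (x↦m , x+1↦0) =
    inj₂ (inj₂ (inj₂ (trans (toℕ-ψ y) (trans (cong rotate (sym x+1≡y)) x+1↦0) , trans (toℕ-ψ x) x↦m)))

  ψ-homomorphism : ∀ {x y} → PathGraph m x y → CycleGraph m (ψ x) (ψ y)
  ψ-homomorphism (inj₁ x+1≡y) = ψ-successor x+1≡y
  ψ-homomorphism (inj₂ y+1≡x) = CycleGraph-sym (ψ-successor y+1≡x)

cycle-rank-lower-bound : ∀ {m r} → (∀ s → HasRanking (PathGraph m) s → r ≤ s) →
                         ∀ s → HasRanking (CycleGraph m) s → suc r ≤ s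
cycle-rank-lower-bound _ zero (h , bounds , _) = ⊥-elim (n≮0 (≤-trans (proj₁ (bounds zero)) (proj₂ (bounds zero))))
cycle-rank-lower-bound {m} path-lower (suc s) (h , bounds , ranks) =
  s≤s (path-lower s (h ∘ ψ , ψ-bounds , Ranks-pullback ψ ψ-homomorphism ψ-injective ranks))
  where
  top : Σ (Fin (suc m)) λ w → ∀ v → v ≢ w → h v < suc s
  top = topLabel-vertex (Ranks-pullback id PathGraph⊆CycleGraph id ranks) (proj₂ ∘ bounds) PathGraph-joined
  open CycleMinusVertex m (proj₁ top)
  ψ-bounds : ∀ i → 1 ≤ h (ψ i) × h (ψ i) ≤ s
  ψ-bounds i = proj₁ (bounds (ψ i)) , ≤-pred (proj₂ top (ψ i) (ψ-≢ i))

extendLast : ∀ {m} → (Fin m → ℕ) → ℕ → Fin (suc m) → ℕ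
extendLast {zero} f t zero = t
extendLast {suc m} f t zero = f zero
extendLast {suc m} f t (suc x) = extendLast (f ∘ suc) t x

extendLast-inject₁ : ∀ {m} (f : Fin m → ℕ) t u → extendLast f t (inject₁ u) ≡ f u
extendLast-inject₁ {suc m} f t zero = refl
extendLast-inject₁ {suc m} f t (suc u) = extendLast-inject₁ (f ∘ suc) t u

extendLast-fromℕ : ∀ m (f : Fin m → ℕ) t → extendLast f t (fromℕ m) ≡ t
extendLast-fromℕ zero f t = refl
extendLast-fromℕ (suc m) f t = extendLast-fromℕ m (f ∘ suc) t

data LastView {m : ℕ} : Fin (suc m) → Set where
  last : LastView (fromℕ m)
  inner : (u : Fin m) → LastView (inject₁ u)

lastView : ∀ {m} (x : Fin (suc m)) → LastView x
lastView {zero} zero = last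
lastView {suc m} zero = inner zero
lastView {suc m} (suc x) with lastView x
... | last = last
... | inner u = inner (suc u)

start∈vertices : ∀ {n} {G : Graph n} {x y} (p : Walk G x y) → x ∈ vertices p
start∈vertices [ x ] = here refl
start∈vertices (e ∷ p) = here refl

module _ {m} {G : Graph m} {H : Graph (suc m)}
         (reflect : ∀ {x y} → H (inject₁ x) (inject₁ y) → G x y) where

  visitsLast-or-lift : ∀ {x y} (p : Walk H x y) {u v} → x ≡ inject₁ u → y ≡ inject₁ v →
    fromℕ m ∈ vertices p ⊎ Σ (Walk G u v) λ q → map inject₁ (vertices q) ≡ vertices p
  visitsLast-or-lift [ x ] refl y≡v with inject₁-injective y≡v
  ... | refl = inj₂ ([ _ ] , refl)
  visitsLast-or-lift (_∷_ {w = w} e p) refl y≡v with lastView w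
  ... | last = inj₁ (there (start∈vertices p))
  ... | inner _ with visitsLast-or-lift p refl y≡v
  ...   | inj₁ visits = inj₁ (there visits)
  ...   | inj₂ (q , q↦p) = inj₂ (reflect e ∷ q , cong (_ ∷_) q↦p)

  extendLast-ranking : ∀ {r f} → IsRanking G r f → IsRanking H (suc r) (extendLast f (suc r))
  extendLast-ranking {r} {f} (bounds , ranks) = g-bounds , g-ranks
    where
    g : Fin (suc m) → ℕ
    g = extendLast f (suc r)

    g-last : g (fromℕ m) ≡ suc r
    g-last = extendLast-fromℕ m f (suc r)

    g-inner : ∀ u → g (inject₁ u) ≡ f u
    g-inner = extendLast-inject₁ f (suc r)

    inner<last : ∀ u → g (inject₁ u) < g (fromℕ m)
    inner<last u = subst₂ _<_ (sym (g-inner u)) (sym g-last) (s≤s (proj₂ (bounds u)))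

    g-bounds : ∀ v → 1 ≤ g v × g v ≤ suc r
    g-bounds v with lastView v
    ... | last = subst (λ t → 1 ≤ t × t ≤ suc r) (sym g-last) (s≤s z≤n , ≤-refl)
    ... | inner u = subst (λ t → 1 ≤ t × t ≤ suc r) (sym (g-inner u)) (proj₁ (bounds u) , m≤n⇒m≤1+n (proj₂ (bounds u)))

    g-ranks : Ranks H g
    g-ranks x y x≢y same p p-path with lastView x | lastView y
    ... | last | last = ⊥-elim (x≢y refl)
    ... | last | inner v = ⊥-elim (<-irrefl (sym same) (inner<last v))
    ... | inner u | last = ⊥-elim (<-irrefl same (inner<last u))
    ... | inner u | inner v with visitsLast-or-lift p refl refl
    ...   | inj₁ visits = Any.map (λ last≡z → subst (λ z → g (inject₁ u) < g z) last≡z (inner<last u)) visits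
    ...   | inj₂ (q , q↦p) = subst (Any _) q↦p (Any.map⁺ (Any.map
              (subst₂ _<_ (sym (g-inner u)) (sym (g-inner _)))
              (ranks u v (x≢y ∘ cong inject₁) (trans (sym (g-inner u)) (trans same (g-inner v))) q
                (Unique.map⁻ (subst Unique (sym q↦p) p-path)))))

CycleGraph-inject₁ : ∀ {m} {x y : Fin m} → CycleGraph m (inject₁ x) (inject₁ y) → PathGraph m x y
CycleGraph-inject₁ {x = x} {y} (inj₁ e) = inj₁ (subst₂ (λ i j → suc i ≡ j) (toℕ-inject₁ x) (toℕ-inject₁ y) e)
CycleGraph-inject₁ {x = x} {y} (inj₂ (inj₁ e)) = inj₂ (subst₂ (λ i j → suc i ≡ j) (toℕ-inject₁ y) (toℕ-inject₁ x) e)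
CycleGraph-inject₁ {y = y} (inj₂ (inj₂ (inj₁ (_ , y≡m)))) = ⊥-elim (toℕ-inject₁-≢ y (sym y≡m))
CycleGraph-inject₁ {x = x} (inj₂ (inj₂ (inj₂ (_ , x≡m)))) = ⊥-elim (toℕ-inject₁-≢ x (sym x≡m))

addEdge-inject₁ : ∀ {m} {a b x y : Fin m} →
  addEdge (CycleGraph m) (inject₁ a) (inject₁ b) (inject₁ x) (inject₁ y) → addEdge (PathGraph m) a b x y
addEdge-inject₁ (inj₁ e) = inj₁ (CycleGraph-inject₁ e)
addEdge-inject₁ (inj₂ (inj₁ (x≡a , y≡b))) = inj₂ (inj₁ (inject₁-injective x≡a , inject₁-injective y≡b))
addEdge-inject₁ (inj₂ (inj₂ (x≡b , y≡a))) = inj₂ (inj₂ (inject₁-injective x≡b , inject₁-injective y≡a))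

proposition4p1 : (k : ℕ) → 1 ≤ k → (a b : Fin (2 ^ k ∸ 1)) →
    a ≢ b → ¬ PathGraph (2 ^ k ∸ 1) a b →
    IsGood (PathGraph (2 ^ k ∸ 1)) a b →
    IsGood (CycleGraph (2 ^ k ∸ 1)) (inject₁ a) (inject₁ b)
proposition4p1 k _ a b _ _ (r , (_ , path-lower) , ((f , f-ranking) , _)) =
  suc r , ((g , IsRanking-subgraph inj₁ g-ranking) , cycle-lower) ,
          ((g , g-ranking) , λ s (h , h-ranking) → cycle-lower s (h , IsRanking-subgraph inj₁ h-ranking))
  where
  g : Fin (suc (2 ^ k ∸ 1)) → ℕ
  g = extendLast f (suc r)
  g-ranking : IsRanking (addEdge (CycleGraph (2 ^ k ∸ 1)) (inject₁ a) (inject₁ b)) (suc r) g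
  g-ranking = extendLast-ranking addEdge-inject₁ f-ranking
  cycle-lower : ∀ s → HasRanking (CycleGraph (2 ^ k ∸ 1)) s → suc r ≤ s
  cycle-lower = cycle-rank-lower-bound path-lower
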